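{- Let $G$ be a graph and let $L$ be a set of specified leaks on $V(G)$ with $I(L)=1$. A set $B\subseteq V(G)$ is an $L$-leaky forcing set of $G$ if and only if $B$ is a specified $1$-leaky forcing set of $G$.
   Context: All graphs are finite simple graphs. Given a graph $G$ and a set $B\subseteq V(G)$ of initially blue vertices (all other vertices white), the zero forcing color-change rule says: if a blue vertex $u$ has exactly one white neighbor $w$, then $u$ may force $w$ (written $u\rightarrow w$). A specified leak $v\rightarrow u$ (for adjacent $v,u$) prohibits the single force of $v$ forcing $u$; $v$ is its tail and $u$ its head. For a set $L$ of specified leaks, $T(L)=\{x: x\rightarrow y\in L\}$ and $H(L)=\{y: x\rightarrow y\in L\}$. A set $B$ is a specified $\ell$-leaky forcing set if $B$ can color all of $G$ blue whenever any set of $\ell$ forces is prohibited. Two sets $L_1,L_2$ of specified leaks on $V(G)$ are isomorphic if there is a bijection $\phi:V(G)\to V(G)$ with $x\rightarrow y\in L_1$ if and only if $\phi(x)\rightarrow\phi(y)\in L_2$. Given a set $L$ of specified leaks on $V(G)$, a set $B$ is an $L$-leaky forcing set if $B$ can color all of $G$ blue despite any set $L_1$ of specified leaks that is isomorphic to some $L_2\subseteq L$. A set $L$ of specified leaks is independent if $|T(L)|=|L|$ and $T(L)\cap H(L)=\varnothing$; $I(L)$ is the size of a largest independent set of specified leaks contained in $L$. -}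

module Defs where

open import Data.Nat using (ℕ; zero; suc; _+_; _≤_)
open import Data.Bool using (Bool; true; false; _∨_; if_then_else_)
open import Data.Fin using (Fin; zero; suc)
open import Data.Fin.Subset using (Subset; _∈_)
open import Data.Product using (Σ; _×_; _,_)
open import Relation.Binary.PropositionalEquality using (_≡_; _≢_)
open import Relation.Nullary using (¬_)
open import Relation.Unary using (Decidable)
open import Function.Bundles using (_↔_; Inverse)
import Relation.Binary as B

record Graph (n : ℕ) : Set₁ where
  field
    Adj    : Fin n → Fin n → Set
    adj?   : B.Decidable Adj
    sym    : ∀ {x y} → Adj x y → Adj y x
    irrefl : ∀ {x} → ¬ Adj x x
open Graph public

sumF : ∀ {n} → (Fin n → ℕ) → ℕ
sumF {zero}  f = 0
sumF {suc n} f = f zero + sumF (λ i → f (suc i))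

anyF : ∀ {n} → (Fin n → Bool) → Bool
anyF {zero}  f = false
anyF {suc n} f = f zero ∨ anyF (λ i → f (suc i))

-- A set of specified leaks on V(G): L x y ≡ true means the leak x → y is in L.
LeakSet : ℕ → Set
LeakSet n = Fin n → Fin n → Bool

count : Bool → ℕ
count b = if b then 1 else 0

size : ∀ {n} → LeakSet n → ℕ
size L = sumF (λ x → sumF (λ y → count (L x y)))

tails : ∀ {n} → LeakSet n → Fin n → Bool
tails L x = anyF (λ y → L x y)

heads : ∀ {n} → LeakSet n → Fin n → Bool
heads L y = anyF (λ x → L x y)

tailCount : ∀ {n} → LeakSet n → ℕ
tailCount L = sumF (λ x → count (tails L x))

_⊆L_ : ∀ {n} → LeakSet n → LeakSet n → Set
L₂ ⊆L L₁ = ∀ x y → L₂ x y ≡ true → L₁ x y ≡ true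

Independent : ∀ {n} → LeakSet n → Set
Independent L = (tailCount L ≡ size L) × (∀ x → tails L x ≡ true → heads L x ≡ false)

IndepNumber : ∀ {n} → LeakSet n → ℕ → Set
IndepNumber L k =
  Σ (LeakSet _) (λ L₂ → L₂ ⊆L L × Independent L₂ × size L₂ ≡ k)
  × (∀ L₂ → L₂ ⊆L L → Independent L₂ → size L₂ ≤ k)

Isomorphic : ∀ {n} → LeakSet n → LeakSet n → Set
Isomorphic {n} L₁ L₂ =
  Σ (Fin n ↔ Fin n) (λ φ → ∀ x y → L₁ x y ≡ L₂ (Inverse.to φ x) (Inverse.to φ y))

data Blue {n} (G : Graph n) (B : Subset n) (L : LeakSet n) : Fin n → Set where
  init  : ∀ {x} → x ∈ B → Blue G B L x
  force : ∀ {u w} → Blue G B L u → Adj G u w → L u w ≡ false →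
          (∀ v → Adj G u v → v ≢ w → Blue G B L v) → Blue G B L w

ForcesDespite : ∀ {n} → Graph n → Subset n → LeakSet n → Set
ForcesDespite {n} G B L = ∀ (x : Fin n) → Blue G B L x

LLeakyForcing : ∀ {n} → Graph n → LeakSet n → Subset n → Set
LLeakyForcing G L B =
  ∀ L₁ L₂ → L₂ ⊆L L → Isomorphic L₁ L₂ → ForcesDespite G B L₁

SpecifiedLeakyForcing : ∀ {n} → Graph n → ℕ → Subset n → Set
SpecifiedLeakyForcing G ℓ B = ∀ L₁ → size L₁ ≤ ℓ → ForcesDespite G B L₁

-- Run the forcing process of B despite a leak set L until it stalls at a set S. Every
-- force still available on S is then a leak of L, and two available forces u → w and
-- u' → w' with u ≢ u' would be an independent pair of leaks (u, u' are blue and w, w'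
-- white). So if L contains no independent pair, at most one force u → w is available
-- on S, and S is equally stalled under the single leak u → w, or under no leak. Hence
-- B forces G despite L once it does so with no leak and despite every single leak
-- along an edge. Both sides of the equivalence amount to exactly this: leak sets of
-- size at most 1, and leak sets isomorphic to subsets of L when I(L) = 1, contain no
-- independent pair; and I(L) = 1 provides a leak a → b with a ≢ b in L, to which every
-- single leak along an edge is isomorphic.

module Submission where

open import Defs hiding (sym)
open import Data.Nat using (ℕ; zero; suc; _+_; _≤_; _<_; z≤n)
open import Data.Nat.Properties
  using (≤-refl; ≤-reflexive; ≤-trans; ≤-pred; <-irrefl; m≤m+n; m≤n+m;
         +-comm; +-identityʳ; +-mono-≤; +-monoʳ-≤; +-mono-<-≤; +-mono-≤-<)
  renaming (_≟_ to _≟ℕ_)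
open import Data.Bool using (Bool; true; false; _∨_; _∧_; not)
open import Data.Bool.Properties using (∨-zeroʳ; ∧-zeroʳ; not-¬; ¬-not)
  renaming (_≟_ to _≟ᵇ_)
open import Data.Fin using (Fin; zero; suc; _≟_)
open import Data.Fin.Properties using (any?; all?; suc-injective)
open import Data.Fin.Subset using (Subset; _∈_)
open import Data.Fin.Subset.Properties using (_∈?_)
open import Data.Fin.Permutation using (Permutation′; transpose; _∘ₚ_; _⟨$⟩ʳ_)
import Data.Fin.Permutation.Components as PC
open import Data.Product using (∃; ∃₂; _×_; _,_)
open import Data.Sum using (_⊎_; inj₁; inj₂)
open import Data.Empty using (⊥-elim)
open import Function using (_∘_)
open import Function.Bundles using (_⇔_; mk⇔; Injection)
open import Function.Properties.Inverse using (↔⇒↣)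
open import Function.Construct.Identity using (↔-id)
open import Relation.Binary.PropositionalEquality
open import Relation.Nullary using (¬_; Dec; yes; no; does)
open import Relation.Nullary.Decidable using (dec-true; dec-false; _×-dec_; _→-dec_; ¬?)

fromDoes : ∀ {A : Set} (d : Dec A) → does d ≡ true → A
fromDoes (yes a) _ = a

-- Sums and disjunctions over Fin n

sumF-cong : ∀ {n} {f g : Fin n → ℕ} → (∀ i → f i ≡ g i) → sumF f ≡ sumF g
sumF-cong {zero}  f≗g = refl
sumF-cong {suc n} f≗g = cong₂ _+_ (f≗g zero) (sumF-cong (f≗g ∘ suc))

sumF-≡0 : ∀ {n} (f : Fin n → ℕ) → (∀ i → f i ≡ 0) → sumF f ≡ 0
sumF-≡0 {zero}  f f≗0 = refl
sumF-≡0 {suc n} f f≗0 = cong₂ _+_ (f≗0 zero) (sumF-≡0 (f ∘ suc) (f≗0 ∘ suc))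

sumF-concentrated : ∀ {n} (f : Fin n → ℕ) (b : Fin n) → (∀ i → i ≢ b → f i ≡ 0) → sumF f ≡ f b
sumF-concentrated f zero    off = begin
  f zero + sumF (f ∘ suc) ≡⟨ cong (f zero +_) (sumF-≡0 (f ∘ suc) (λ i → off (suc i) λ ())) ⟩
  f zero + 0              ≡⟨ +-identityʳ (f zero) ⟩
  f zero                  ∎
  where open ≡-Reasoning
sumF-concentrated f (suc b) off =
  cong₂ _+_ (off zero λ ())
            (sumF-concentrated (f ∘ suc) b (λ i i≢b → off (suc i) (i≢b ∘ suc-injective)))

f≤sumF : ∀ {n} (f : Fin n → ℕ) (i : Fin n) → f i ≤ sumF f
f≤sumF f zero    = m≤m+n _ _
f≤sumF f (suc i) = ≤-trans (f≤sumF (f ∘ suc) i) (m≤n+m _ _)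

f+f≤sumF : ∀ {n} (f : Fin n → ℕ) {i j : Fin n} → i ≢ j → f i + f j ≤ sumF f
f+f≤sumF f {zero}  {zero}  i≢j = ⊥-elim (i≢j refl)
f+f≤sumF f {zero}  {suc j} _   = +-monoʳ-≤ (f zero) (f≤sumF (f ∘ suc) j)
f+f≤sumF f {suc i} {zero}  _   =
  ≤-trans (≤-reflexive (+-comm (f (suc i)) (f zero))) (+-monoʳ-≤ (f zero) (f≤sumF (f ∘ suc) i))
f+f≤sumF f {suc i} {suc j} i≢j = ≤-trans (f+f≤sumF (f ∘ suc) (i≢j ∘ cong suc)) (m≤n+m _ _)

sumF-mono-≤ : ∀ {n} (f g : Fin n → ℕ) → (∀ i → f i ≤ g i) → sumF f ≤ sumF g
sumF-mono-≤ {zero}  f g f≤g = z≤n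
sumF-mono-≤ {suc n} f g f≤g = +-mono-≤ (f≤g zero) (sumF-mono-≤ (f ∘ suc) (g ∘ suc) (f≤g ∘ suc))

sumF-mono-< : ∀ {n} (f g : Fin n → ℕ) → (∀ i → f i ≤ g i) → ∀ w → f w < g w → sumF f < sumF g
sumF-mono-< f g f≤g zero    fw<gw = +-mono-<-≤ fw<gw (sumF-mono-≤ (f ∘ suc) (g ∘ suc) (f≤g ∘ suc))
sumF-mono-< f g f≤g (suc w) fw<gw =
  +-mono-≤-< (f≤g zero) (sumF-mono-< (f ∘ suc) (g ∘ suc) (f≤g ∘ suc) w fw<gw)

sumF-nonzero : ∀ {n} (f : Fin n → ℕ) → sumF f ≢ 0 → ∃ λ i → f i ≢ 0
sumF-nonzero {zero}  f sum≢0 = ⊥-elim (sum≢0 refl)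
sumF-nonzero {suc n} f sum≢0 with f zero ≟ℕ 0
... | no f0≢0  = zero , f0≢0
... | yes f0≡0 with sumF-nonzero (f ∘ suc) (λ rest≡0 → sum≢0 (cong₂ _+_ f0≡0 rest≡0))
...   | i , fi≢0 = suc i , fi≢0

anyF-intro : ∀ {n} (f : Fin n → Bool) (i : Fin n) → f i ≡ true → anyF f ≡ true
anyF-intro f zero    fi = cong (_∨ anyF (f ∘ suc)) fi
anyF-intro f (suc i) fi = trans (cong (f zero ∨_) (anyF-intro (f ∘ suc) i fi)) (∨-zeroʳ (f zero))

anyF-≡false : ∀ {n} (f : Fin n → Bool) → (∀ i → f i ≡ false) → anyF f ≡ false
anyF-≡false {zero}  f f≗false = refl
anyF-≡false {suc n} f f≗false = cong₂ _∨_ (f≗false zero) (anyF-≡false (f ∘ suc) (f≗false ∘ suc))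

anyF-witness : ∀ {n} (f : Fin n → Bool) → anyF f ≡ true → ∃ λ i → f i ≡ true
anyF-witness {suc n} f any with f zero in f0
... | true  = zero , f0
... | false with anyF-witness (f ∘ suc) any
...   | i , fi = suc i , fi

count-anyF : ∀ {n} (f : Fin n → Bool) → (∀ i j → f i ≡ true → f j ≡ true → i ≡ j) →
  count (anyF f) ≡ sumF (count ∘ f)
count-anyF {zero}  f unique = refl
count-anyF {suc n} f unique with f zero in f0
... | true  = sym (cong suc (sumF-≡0 (count ∘ f ∘ suc) offZero))
  where
  offZero : ∀ i → count (f (suc i)) ≡ 0
  offZero i with f (suc i) in fi
  ... | true  with () ← unique zero (suc i) f0 fi
  ... | false = refl
... | false = count-anyF (f ∘ suc) (λ i j fi fj → suc-injective (unique (suc i) (suc j) fi fj))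

-- Leak sets

_==_ : ∀ {n} → Fin n → Fin n → Bool
x == y = does (x ≟ y)

==-refl : ∀ {n} (x : Fin n) → (x == x) ≡ true
==-refl x = dec-true (x ≟ x) refl

==-≢ : ∀ {n} {x y : Fin n} → x ≢ y → (x == y) ≡ false
==-≢ {x = x} {y} x≢y = dec-false (x ≟ y) x≢y

==-true : ∀ {n} {x y : Fin n} → (x == y) ≡ true → x ≡ y
==-true {x = x} {y} = fromDoes (x ≟ y)

==-injective : ∀ {n} (f : Fin n → Fin n) → (∀ {x y} → f x ≡ f y → x ≡ y) →
  ∀ x y → (x == y) ≡ (f x == f y)
==-injective f injective x y with x ≟ y
... | yes refl = sym (==-refl (f x))
... | no x≢y   = sym (==-≢ (x≢y ∘ injective))

noLeaks : ∀ {n} → LeakSet n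
noLeaks _ _ = false

singleLeak : ∀ {n} → Fin n → Fin n → LeakSet n
singleLeak u w x y = (x == u) ∧ (y == w)

leakPair : ∀ {n} → Fin n → Fin n → Fin n → Fin n → LeakSet n
leakPair a b c d x y = singleLeak a b x y ∨ singleLeak c d x y

singleLeak-self : ∀ {n} (u w : Fin n) → singleLeak u w u w ≡ true
singleLeak-self u w = cong₂ _∧_ (==-refl u) (==-refl w)

singleLeak-true : ∀ {n} {u w x y : Fin n} → singleLeak u w x y ≡ true → x ≡ u × y ≡ w
singleLeak-true {u = u} {x = x} xy with x == u in x≡u
... | true = ==-true x≡u , ==-true xy

leakPair-true : ∀ {n} {a b c d x y : Fin n} → leakPair a b c d x y ≡ true →
  (x ≡ a × y ≡ b) ⊎ (x ≡ c × y ≡ d)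
leakPair-true {a = a} {b} {x = x} {y} xy with singleLeak a b x y in abxy
... | true  = inj₁ (singleLeak-true abxy)
... | false = inj₂ (singleLeak-true xy)

singleLeak-⊆ : ∀ {n} {L : LeakSet n} {u w} → L u w ≡ true → singleLeak u w ⊆L L
singleLeak-⊆ {L = L} {u} {w} Luw x y xy with singleLeak-true {u = u} {w} {x} {y} xy
... | refl , refl = Luw

size-noLeaks : ∀ {n} → size (noLeaks {n}) ≡ 0
size-noLeaks {n} = sumF-≡0 {n} _ (λ _ → sumF-≡0 {n} _ (λ _ → refl))

size-singleLeak : ∀ {n} (u w : Fin n) → size (singleLeak u w) ≡ 1
size-singleLeak u w = begin
  size (singleLeak u w)           ≡⟨ sumF-concentrated _ u offRow ⟩
  sumF (count ∘ singleLeak u w u) ≡⟨ sumF-concentrated _ w offColumn ⟩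
  count (singleLeak u w u w)      ≡⟨ cong count (singleLeak-self u w) ⟩
  1                               ∎
  where
  open ≡-Reasoning
  offRow : ∀ x → x ≢ u → sumF (count ∘ singleLeak u w x) ≡ 0
  offRow x x≢u = sumF-≡0 _ (λ y → cong (λ b → count (b ∧ (y == w))) (==-≢ x≢u))
  offColumn : ∀ y → y ≢ w → count (singleLeak u w u y) ≡ 0
  offColumn y y≢w = cong count (trans (cong ((u == u) ∧_) (==-≢ y≢w)) (∧-zeroʳ (u == u)))

nonempty : ∀ {n} (L : LeakSet n) → size L ≢ 0 → ∃₂ λ x y → L x y ≡ true
nonempty L size≢0 with sumF-nonzero _ size≢0
... | x , row≢0 with sumF-nonzero _ row≢0
...   | y , entry≢0 with L x y in Lxy
...     | true  = x , y , Lxy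
...     | false = ⊥-elim (entry≢0 refl)

2≤size : ∀ {n} (L : LeakSet n) {a b c d} → L a b ≡ true → L c d ≡ true → a ≢ c → 2 ≤ size L
2≤size {n} L {a} {b} {c} {d} Lab Lcd a≢c =
  ≤-trans (+-mono-≤ (1≤row Lab) (1≤row Lcd)) (f+f≤sumF row a≢c)
  where
  row : Fin n → ℕ
  row x = sumF (count ∘ L x)
  1≤row : ∀ {x y} → L x y ≡ true → 1 ≤ row x
  1≤row {x} {y} Lxy = ≤-trans (≤-reflexive (cong count (sym Lxy))) (f≤sumF (count ∘ L x) y)

tailCount≡size : ∀ {n} (L : LeakSet n) → (∀ x y y' → L x y ≡ true → L x y' ≡ true → y ≡ y') →
  tailCount L ≡ size L
tailCount≡size L functional = sumF-cong (λ x → count-anyF (L x) (functional x))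

Independent⇒irreflexive : ∀ {n} {L : LeakSet n} {x y} → Independent L → L x y ≡ true → x ≢ y
Independent⇒irreflexive {L = L} {x} (_ , disjoint) Lxy refl =
  not-¬ (anyF-intro (λ z → L z x) x Lxy) (disjoint x (anyF-intro (L x) x Lxy))

-- Independent pairs of leaks

record IndependentPair {n} (L : LeakSet n) : Set where
  field
    a b c d : Fin n
    leak₁ : L a b ≡ true
    leak₂ : L c d ≡ true
    a≢b : a ≢ b
    c≢d : c ≢ d
    a≢c : a ≢ c
    a≢d : a ≢ d
    c≢b : c ≢ b

IndependentPair-⊆ : ∀ {n} {L₁ L₂ : LeakSet n} → L₁ ⊆L L₂ → IndependentPair L₁ → IndependentPair L₂
IndependentPair-⊆ L₁⊆L₂ p = record
  { a = a ; b = b ; c = c ; d = d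
  ; leak₁ = L₁⊆L₂ a b leak₁ ; leak₂ = L₁⊆L₂ c d leak₂
  ; a≢b = a≢b ; c≢d = c≢d ; a≢c = a≢c ; a≢d = a≢d ; c≢b = c≢b
  }
  where open IndependentPair p

IndependentPair-iso : ∀ {n} {L₁ L₂ : LeakSet n} → Isomorphic L₁ L₂ →
  IndependentPair L₁ → IndependentPair L₂
IndependentPair-iso (φ , preserves) p = record
  { a = f a ; b = f b ; c = f c ; d = f d
  ; leak₁ = trans (sym (preserves a b)) leak₁
  ; leak₂ = trans (sym (preserves c d)) leak₂
  ; a≢b = a≢b ∘ injective ; c≢d = c≢d ∘ injective ; a≢c = a≢c ∘ injective
  ; a≢d = a≢d ∘ injective ; c≢b = c≢b ∘ injective
  }
  where
  open IndependentPair p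
  open Injection (↔⇒↣ φ) using (injective) renaming (to to f)

size≤1⇒¬IndependentPair : ∀ {n} {L : LeakSet n} → size L ≤ 1 → ¬ IndependentPair L
size≤1⇒¬IndependentPair {L = L} size≤1 p = <-irrefl refl (≤-trans (2≤size L leak₁ leak₂ a≢c) size≤1)
  where open IndependentPair p

module _ {n} {L : LeakSet n} (p : IndependentPair L) where
  open IndependentPair p

  pairLeaks : LeakSet n
  pairLeaks = leakPair a b c d

  pairLeaks-true : ∀ x y → pairLeaks x y ≡ true → (x ≡ a × y ≡ b) ⊎ (x ≡ c × y ≡ d)
  pairLeaks-true x y = leakPair-true {a = a} {b} {c} {d} {x} {y}

  pairLeaks-⊆ : pairLeaks ⊆L L
  pairLeaks-⊆ x y xy with pairLeaks-true x y xy
  ... | inj₁ (refl , refl) = leak₁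
  ... | inj₂ (refl , refl) = leak₂

  2≤size-pairLeaks : 2 ≤ size pairLeaks
  2≤size-pairLeaks = 2≤size pairLeaks {a} {b} {c} {d}
    (cong (_∨ singleLeak c d a b) (singleLeak-self a b))
    (trans (cong (singleLeak a b c d ∨_) (singleLeak-self c d)) (∨-zeroʳ _)) a≢c

  pairLeaks-independent : Independent pairLeaks
  pairLeaks-independent = tailCount≡size pairLeaks functional , tails∩heads≡∅
    where
    functional : ∀ x y y' → pairLeaks x y ≡ true → pairLeaks x y' ≡ true → y ≡ y'
    functional x y y' xy xy' with pairLeaks-true x y xy | pairLeaks-true x y' xy'
    ... | inj₁ (refl , refl) | inj₁ (_ , refl) = refl
    ... | inj₁ (refl , _)    | inj₂ (x≡c , _)  = ⊥-elim (a≢c x≡c)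
    ... | inj₂ (refl , _)    | inj₁ (x≡a , _)  = ⊥-elim (a≢c (sym x≡a))
    ... | inj₂ (refl , refl) | inj₂ (_ , refl) = refl
    tails∩heads≡∅ : ∀ x → tails pairLeaks x ≡ true → heads pairLeaks x ≡ false
    tails∩heads≡∅ x tail with anyF-witness _ tail
    ... | y , xy = anyF-≡false _ notHead
      where
      notHead : ∀ z → pairLeaks z x ≡ false
      notHead z with pairLeaks z x in zx
      ... | false = refl
      ... | true with pairLeaks-true x y xy | pairLeaks-true z x zx
      ...   | inj₁ (refl , _) | inj₁ (_ , refl) = ⊥-elim (a≢b refl)
      ...   | inj₁ (refl , _) | inj₂ (_ , refl) = ⊥-elim (a≢d refl)
      ...   | inj₂ (refl , _) | inj₁ (_ , refl) = ⊥-elim (c≢b refl)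
      ...   | inj₂ (refl , _) | inj₂ (_ , refl) = ⊥-elim (c≢d refl)

IndepNumber1⇒¬IndependentPair : ∀ {n} {L : LeakSet n} → IndepNumber L 1 → ¬ IndependentPair L
IndepNumber1⇒¬IndependentPair (_ , maximal) p =
  <-irrefl refl (≤-trans (2≤size-pairLeaks p) (maximal _ (pairLeaks-⊆ p) (pairLeaks-independent p)))

IndepNumber1⇒leak : ∀ {n} {L : LeakSet n} → IndepNumber L 1 → ∃₂ λ a b → a ≢ b × L a b ≡ true
IndepNumber1⇒leak ((L₂ , L₂⊆L , independent , size≡1) , _)
  with nonempty L₂ (subst (_≢ 0) (sym size≡1) λ ())
... | a , b , L₂ab = a , b , Independent⇒irreflexive independent L₂ab , L₂⊆L a b L₂ab

-- Isomorphic single leaks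

transpose-matchˡ : ∀ {n} (i j : Fin n) → PC.transpose i j i ≡ j
transpose-matchˡ i j rewrite dec-true (i ≟ i) refl = refl

transpose-other : ∀ {n} {i j k : Fin n} → k ≢ i → k ≢ j → PC.transpose i j k ≡ k
transpose-other {i = i} {j} {k} k≢i k≢j rewrite dec-false (k ≟ i) k≢i | dec-false (k ≟ j) k≢j = refl

permutation-sending : ∀ {n} {u w a b : Fin n} → u ≢ w → a ≢ b →
  ∃ λ (π : Permutation′ n) → π ⟨$⟩ʳ u ≡ a × π ⟨$⟩ʳ w ≡ b
permutation-sending {n} {u} {w} {a} {b} u≢w a≢b =
  transpose u a ∘ₚ transpose w′ b , π-u , transpose-matchˡ w′ b
  where
  w′ : Fin n
  w′ = PC.transpose u a w
  a≢w′ : a ≢ w′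
  a≢w′ a≡w′ = u≢w (Injection.injective (↔⇒↣ (transpose u a)) (trans (transpose-matchˡ u a) a≡w′))
  π-u : PC.transpose w′ b (PC.transpose u a u) ≡ a
  π-u rewrite transpose-matchˡ u a = transpose-other a≢w′ a≢b

singleLeak-iso : ∀ {n} {u w a b : Fin n} → u ≢ w → a ≢ b → Isomorphic (singleLeak u w) (singleLeak a b)
singleLeak-iso {u = u} {w} {a} {b} u≢w a≢b with permutation-sending u≢w a≢b
... | π , πu≡a , πw≡b = π , λ x y → cong₂ _∧_
  (trans (==-injective f injective x u) (cong (f x ==_) πu≡a))
  (trans (==-injective f injective y w) (cong (f y ==_) πw≡b))
  where open Injection (↔⇒↣ π) using (injective) renaming (to to f)

-- The stalled forcing process

module Forcing {n : ℕ} (G : Graph n) where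

  adj⇒≢ : ∀ {u w} → Adj G u w → u ≢ w
  adj⇒≢ u~w refl = irrefl G u~w

  blue≢white : ∀ {S : Fin n → Bool} {x y} → S x ≡ true → S y ≡ false → x ≢ y
  blue≢white Sx Sy refl = not-¬ Sx Sy

  Forceable : (Fin n → Bool) → Fin n → Fin n → Set
  Forceable S u w = S u ≡ true × S w ≡ false × Adj G u w × (∀ v → Adj G u v → v ≢ w → S v ≡ true)

  forceable? : ∀ S u w → Dec (Forceable S u w)
  forceable? S u w = (S u ≟ᵇ true) ×-dec (S w ≟ᵇ false) ×-dec adj? G u w ×-dec
    all? (λ v → adj? G u v →-dec ¬? (v ≟ w) →-dec (S v ≟ᵇ true))

  Stalled : LeakSet n → (Fin n → Bool) → Set
  Stalled L S = ∀ u w → Forceable S u w → L u w ≡ true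

  blue⇒∈stalled : ∀ {B L S x} → Stalled L S → (∀ y → y ∈ B → S y ≡ true) →
    Blue G B L x → S x ≡ true
  blue⇒∈stalled st B⊆S (init x∈B) = B⊆S _ x∈B
  blue⇒∈stalled {S = S} st B⊆S (force {u} {w} blue-u u~w free others) with S w in Sw
  ... | true  = refl
  ... | false = ⊥-elim (not-¬ (st u w forceable) free)
    where
    forceable : Forceable S u w
    forceable = blue⇒∈stalled st B⊆S blue-u , Sw , u~w ,
                λ v u~v v≢w → blue⇒∈stalled st B⊆S (others v u~v v≢w)

  forceable-unique : ∀ {L S u w u' w'} → ¬ IndependentPair L → Stalled L S →
    Forceable S u w → Forceable S u' w' → u ≡ u' × w ≡ w'
  forceable-unique {u = u} {w} {u'} {w'} noPair st f@(Su , Sw , u~w , others) f'@(Su' , Sw' , u'~w' , _)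
    with u ≟ u'
  ... | yes refl with w ≟ w'
  ...   | yes refl = refl , refl
  ...   | no w≢w'  = ⊥-elim (not-¬ (others w' u'~w' (w≢w' ∘ sym)) Sw')
  forceable-unique {u = u} {w} {u'} {w'} noPair st f@(Su , Sw , u~w , _) f'@(Su' , Sw' , u'~w' , _)
    | no u≢u' = ⊥-elim (noPair record
      { a = u ; b = w ; c = u' ; d = w'
      ; leak₁ = st u w f ; leak₂ = st u' w' f'
      ; a≢b = adj⇒≢ u~w ; c≢d = adj⇒≢ u'~w' ; a≢c = u≢u'
      ; a≢d = blue≢white Su Sw' ; c≢b = blue≢white Su' Sw
      })

  record TerminalSet (B : Subset n) (L : LeakSet n) : Set where
    field
      S : Fin n → Bool
      S⊆blue : ∀ x → S x ≡ true → Blue G B L x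
      B⊆S : ∀ x → x ∈ B → S x ≡ true
      stalled : Stalled L S

  whites : (Fin n → Bool) → ℕ
  whites S = sumF (count ∘ not ∘ S)

  whites-< : ∀ (S S' : Fin n → Bool) {w} → (∀ x → S x ≡ true → S' x ≡ true) →
    S w ≡ false → S' w ≡ true → whites S' < whites S
  whites-< S S' {w} S⊆S' Sw S'w = sumF-mono-< _ _ pointwise w atW
    where
    atW : count (not (S' w)) < count (not (S w))
    atW rewrite Sw | S'w = ≤-refl
    pointwise : ∀ x → count (not (S' x)) ≤ count (not (S x))
    pointwise x with S x in Sx
    ... | true rewrite S⊆S' x Sx = z≤n
    ... | false with S' x
    ...   | true  = z≤n
    ...   | false = ≤-refl

  white⇒0<whites : ∀ (S : Fin n → Bool) {w} → S w ≡ false → 0 < whites S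
  white⇒0<whites S {w} Sw = subst (_≤ whites S) (cong (count ∘ not) Sw) (f≤sumF (count ∘ not ∘ S) w)

  module _ (B : Subset n) (L : LeakSet n) where

    grow : ∀ k (S : Fin n → Bool) → whites S ≤ k → (∀ x → S x ≡ true → Blue G B L x) →
      (∀ x → x ∈ B → S x ≡ true) → TerminalSet B L
    grow k S whites≤k S⊆blue B⊆S
      with any? (λ u → any? (λ w → forceable? S u w ×-dec (L u w ≟ᵇ false)))
    ... | no noFreeForce = record
      { S = S ; S⊆blue = S⊆blue ; B⊆S = B⊆S
      ; stalled = λ u w f → ¬-not (λ free → noFreeForce (u , w , f , free))
      }
    ... | yes (u , w , (Su , Sw , u~w , others) , free) with k
    ...   | zero   = ⊥-elim (<-irrefl refl (≤-trans (white⇒0<whites S Sw) whites≤k))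
    ...   | suc k' =
      grow k' S' (≤-pred (≤-trans (whites-< S S' S⊆S' Sw S'w) whites≤k)) S'⊆blue (λ x → S⊆S' x ∘ B⊆S x)
      where
      S' : Fin n → Bool
      S' x = S x ∨ (x == w)
      S⊆S' : ∀ x → S x ≡ true → S' x ≡ true
      S⊆S' x Sx = cong (_∨ (x == w)) Sx
      S'w : S' w ≡ true
      S'w = trans (cong (S w ∨_) (==-refl w)) (∨-zeroʳ (S w))
      S'⊆blue : ∀ x → S' x ≡ true → Blue G B L x
      S'⊆blue x S'x with S x in Sx
      ... | true  = S⊆blue x Sx
      ... | false with refl ← ==-true {x = x} {w} S'x =
        force (S⊆blue u Su) u~w free (λ v u~v v≢w → S⊆blue v (others v u~v v≢w))

    terminalSet : TerminalSet B L
    terminalSet = grow (whites initial) initial ≤-refl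
      (λ x x∈B → init (fromDoes (x ∈? B) x∈B)) (λ x x∈B → dec-true (x ∈? B) x∈B)
      where
      initial : Fin n → Bool
      initial x = does (x ∈? B)

  forcesDespite-bySingleLeaks : ∀ {B L} → ¬ IndependentPair L → ForcesDespite G B noLeaks →
    (∀ u w → Adj G u w → ForcesDespite G B (singleLeak u w)) → ForcesDespite G B L
  forcesDespite-bySingleLeaks {B} {L} noPair withoutLeaks despiteSingle x = S⊆blue x (S-full x)
    where
    open TerminalSet (terminalSet B L)
    S-full : ∀ x → S x ≡ true
    S-full with any? (λ u → any? (λ w → forceable? S u w))
    ... | no noForce = λ x →
      blue⇒∈stalled (λ u w f → ⊥-elim (noForce (u , w , f))) B⊆S (withoutLeaks x)
    ... | yes (u , w , f@(_ , _ , u~w , _)) = λ x →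
      blue⇒∈stalled stalledSingle B⊆S (despiteSingle u w u~w x)
      where
      stalledSingle : Stalled (singleLeak u w) S
      stalledSingle u' w' f' with forceable-unique noPair stalled f f'
      ... | refl , refl = singleLeak-self u w

open Forcing using (forcesDespite-bySingleLeaks; adj⇒≢)

proposition5p2 : ∀ {n : ℕ} (G : Graph n) (L : LeakSet n) → IndepNumber L 1 →
    (B : Subset n) → LLeakyForcing G L B ⇔ SpecifiedLeakyForcing G 1 B
proposition5p2 {n} G L I≡1 B = mk⇔ leaky⇒specified specified⇒leaky
  where
  leaky⇒specified : LLeakyForcing G L B → SpecifiedLeakyForcing G 1 B
  leaky⇒specified leaky L₁ size≤1 with IndepNumber1⇒leak I≡1
  ... | a , b , a≢b , Lab = forcesDespite-bySingleLeaks G (size≤1⇒¬IndependentPair size≤1)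
    (leaky noLeaks noLeaks (λ _ _ ()) (↔-id _ , λ _ _ → refl))
    (λ u w u~w → leaky (singleLeak u w) (singleLeak a b) (singleLeak-⊆ Lab)
                       (singleLeak-iso (adj⇒≢ G u~w) a≢b))

  specified⇒leaky : SpecifiedLeakyForcing G 1 B → LLeakyForcing G L B
  specified⇒leaky specified L₁ L₂ L₂⊆L L₁≅L₂ = forcesDespite-bySingleLeaks G
    (IndepNumber1⇒¬IndependentPair I≡1 ∘ IndependentPair-⊆ L₂⊆L ∘ IndependentPair-iso L₁≅L₂)
    (specified noLeaks (subst (_≤ 1) (sym (size-noLeaks {n})) z≤n))
    (λ u w _ → specified (singleLeak u w) (≤-reflexive (size-singleLeak u w)))
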